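{- Let $G=(V,E)$ be a graph and $e=\{u,v\}\in E$. Then $$\mathrm{ID}(G,x)=\mathrm{ID}(G-e,x)-x^2\,\mathrm{ID}(G-N[u,v],x)+x\,\mathrm{ID}(G\circ v-N[u],x)+x\,\mathrm{ID}(G\circ u-N[v],x).$$
   Context: All graphs are finite and undirected; $G$ is simple. $N_G(w)$ is the open neighborhood of $w$ and $N_G[w]=N_G(w)\cup\{w\}$. $G-e$ removes the edge $e$. $G-N[u,v]$ is the graph obtained from $G$ by deleting all vertices of $N_G[u]\cup N_G[v]$. $G\circ v$ is obtained from $G$ by deleting $v$ and adding a loop at every vertex of $N_G(v)$. $G\circ v-N[u]$ is obtained from $G\circ v$ by deleting the closed neighborhood of $u$ in $G\circ v$, namely $N_G[u]\setminus\{v\}$; $G\circ u-N[v]$ is defined symmetrically. For a graph $H$ possibly with loops, a vertex set $W$ is an independent dominating set if no vertex of $W$ carries a loop, no two vertices of $W$ are adjacent, and every vertex not in $W$ is adjacent to some vertex of $W$ (a loop does not dominate its own vertex). $\mathrm{ID}(H,x)=\sum_W x^{|W|}$ over all independent dominating sets $W$ of $H$. For the graph with no vertices, $\mathrm{ID}=1$. -}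

module Defs where

open import Data.Bool using (Bool; true; false; _∧_; _∨_; not; if_then_else_)
open import Data.Nat using (ℕ; zero; suc)
open import Data.Integer using (ℤ; +_; _+_; _-_; 0ℤ)
open import Data.Fin using (Fin; _≟_)
open import Data.Fin.Subset using (Subset; ∣_∣)
open import Data.Vec using (Vec; []; _∷_; lookup)
open import Data.List using (List; [_]; _++_; map; allFin; filter; length)
open import Data.Bool.ListAction using (and; or)
open import Relation.Nullary.Decidable using (⌊_⌋)
open import Relation.Binary.PropositionalEquality using (_≡_)
open import Data.Bool.Properties using (T?)

allV : {n : ℕ} → (Fin n → Bool) → Bool
allV {n} p = and (map p (allFin n))

anyV : {n : ℕ} → (Fin n → Bool) → Bool
anyV {n} p = or (map p (allFin n))

_==_ : {n : ℕ} → Fin n → Fin n → Bool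
a == b = ⌊ a ≟ b ⌋

record SimpleGraph (n : ℕ) : Set where
  field
    adj   : Fin n → Fin n → Bool
    sym   : ∀ a b → adj a b ≡ adj b a
    irrfl : ∀ a → adj a a ≡ false
open SimpleGraph public

-- Graphs possibly with loops, whose vertex set is a subset of Fin n.
-- `present w` says w is a vertex; `ladj a a = true` is a loop at a.
-- Only adjacencies between present vertices are ever consulted.

record LGraph (n : ℕ) : Set where
  constructor lgraph
  field
    present : Fin n → Bool
    ladj    : Fin n → Fin n → Bool
open LGraph public

toL : {n : ℕ} → SimpleGraph n → LGraph n
toL G = lgraph (λ _ → true) (adj G)

deleteEdge : {n : ℕ} → LGraph n → Fin n → Fin n → LGraph n
deleteEdge H u v = lgraph (present H)
  (λ a b → ladj H a b ∧ not (((a == u) ∧ (b == v)) ∨ ((a == v) ∧ (b == u))))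

inClosedNbhd : {n : ℕ} → LGraph n → Fin n → Fin n → Bool
inClosedNbhd H u w = present H w ∧ ((w == u) ∨ ladj H u w)

deleteClosedNbhd : {n : ℕ} → LGraph n → Fin n → LGraph n
deleteClosedNbhd H u =
  lgraph (λ w → present H w ∧ not (inClosedNbhd H u w)) (ladj H)

deleteClosedNbhd2 : {n : ℕ} → LGraph n → Fin n → Fin n → LGraph n
deleteClosedNbhd2 H u v =
  lgraph (λ w → present H w ∧ not (inClosedNbhd H u w ∨ inClosedNbhd H v w))
         (ladj H)

circ : {n : ℕ} → LGraph n → Fin n → LGraph n
circ H v = lgraph (λ w → present H w ∧ not (w == v))
  (λ a b → ladj H a b ∨ ((a == b) ∧ present H a ∧ ladj H v a))

isIDS : {n : ℕ} → LGraph n → Subset n → Bool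
isIDS H W =
     allV (λ w → not (lookup W w) ∨ present H w)
  ∧  allV (λ w → not (lookup W w) ∨ not (ladj H w w))
  ∧  allV (λ a → allV (λ b →
        not (lookup W a ∧ lookup W b ∧ not (a == b)) ∨ not (ladj H a b)))
  ∧  allV (λ w → not (present H w ∧ not (lookup W w)) ∨
        anyV (λ w' → lookup W w' ∧ not (w == w') ∧ ladj H w w'))

allSubsets : (n : ℕ) → List (Subset n)
allSubsets zero    = [ [] ]
allSubsets (suc n) = map (true ∷_) (allSubsets n) ++ map (false ∷_) (allSubsets n)

Poly : Set
Poly = ℕ → ℤ

_⊕_ : Poly → Poly → Poly
(p ⊕ q) k = p k + q k

_⊖_ : Poly → Poly → Poly
(p ⊖ q) k = p k - q k

X^_·_ : ℕ → Poly → Poly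
(X^ zero · p) k          = p k
(X^ suc m · p) zero      = 0ℤ
(X^ suc m · p) (suc k)   = (X^ m · p) k

infixl 6 _⊕_ _⊖_
infixr 7 X^_·_

ID : {n : ℕ} → LGraph n → Poly
ID {n} H k = + length (filter (λ W → T? (isIDS H W ∧ ⌊ ∣ W ∣ Data.Nat.≟ k ⌋)) (allSubsets n))

-- The proof is bijective and sorts the vertex sets W by W ∩ {u,v}:
--   * u, v ∉ W : W is an IDS of G iff it is one of G - e, since the edge uv is not seen from W;
--   * u ∈ W, v ∉ W : an IDS W of G is one of G - e iff v has a neighbour in W other than u, and
--     otherwise exactly W ∖ u is an IDS of G ∘ v - N[u] (symmetrically when v ∈ W, u ∉ W);
--   * u, v ∈ W : W is not an IDS of G, and it is one of G - e iff W ∖ {u,v} is one of G - N[u,v].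
-- So every W is counted equally often by ID(G) + x² ID(G - N[u,v]) and by the other three terms.
-- The graph theory rests on general facts about independent dominating sets of graphs with loops,
-- proved first: they only see the vertex set and the edges into W (transfer), a member x can be
-- removed together with N[x] (peel), and loops merely exclude vertices (addLoops).

module Submission where

open import Defs hiding (sym)
open import Data.Nat as ℕ using (ℕ; zero; suc; _+_)
open import Data.Nat.Properties using (+-identityʳ; +-comm; suc-injective)
open import Data.Nat.Tactic.RingSolver using (solve-∀)
open import Data.Integer as ℤ using (+_)
open import Data.Integer.Properties using (pos-+)
import Data.Integer.Tactic.RingSolver as ℤ-Solver
open import Data.Fin using (Fin; zero; suc; _≟_)
open import Data.Fin.Subset using (Subset; ∣_∣)
open import Data.Bool using (Bool; true; false; _∧_; _∨_; not; T)
open import Data.Bool.Properties using (T?; ∧-identityʳ; ∧-zeroʳ; ∧-comm; ∨-comm)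
open import Data.Vec using (_∷_; lookup; _[_]≔_)
open import Data.Vec.Properties using (lookup∘update; lookup∘update′)
open import Data.List using (List; []; _∷_; _++_; map; filter; length; allFin)
open import Data.List.Properties using (filter-++; length-++)
open import Data.List.Relation.Unary.All as All using (All)
open import Data.List.Relation.Unary.All.Properties using (all⁺; all⁻)
open import Data.List.Relation.Unary.Any using (satisfied)
open import Data.List.Relation.Unary.Any.Properties using (any⁺; any⁻)
open import Data.List.Membership.Propositional using (lose)
open import Data.List.Membership.Propositional.Properties using (∈-allFin)
open import Data.Product using (_×_; _,_; proj₁; proj₂; ∃-syntax)
open import Data.Sum using (_⊎_; inj₁; inj₂)
open import Data.Empty using (⊥-elim)
open import Function.Bundles using (mk⇔)
open import Relation.Nullary using (¬_; yes; no)
open import Relation.Nullary.Decidable using (⌊_⌋; does; isYes≗does; does-⇔)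
open import Relation.Binary.PropositionalEquality
  using (_≡_; _≢_; refl; sym; trans; subst; cong; cong₂; module ≡-Reasoning)

T-∧-intro : ∀ {x y} → T x → T y → T (x ∧ y)
T-∧-intro {true} _ ty = ty

T-∧-fst : ∀ x {y} → T (x ∧ y) → T x
T-∧-fst true _ = _

T-∧-snd : ∀ x {y} → T (x ∧ y) → T y
T-∧-snd true t = t

T-not-intro : ∀ {x} → ¬ T x → T (not x)
T-not-intro {false} _ = _
T-not-intro {true} ¬t = ¬t _

T-not-elim : ∀ {x} → T (not x) → ¬ T x
T-not-elim {true} ()

T-⇒-intro : ∀ {x y} → (T x → T y) → T (not x ∨ y)
T-⇒-intro {false} _ = _
T-⇒-intro {true} f = f _

T-⇒-elim : ∀ {x y} → T (not x ∨ y) → T x → T y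
T-⇒-elim {true} t _ = t

T-∨-inl : ∀ {x y} → T x → T (x ∨ y)
T-∨-inl {true} _ = _

T-∨-inr : ∀ x {y} → T y → T (x ∨ y)
T-∨-inr true  _  = _
T-∨-inr false ty = ty

T-∨-elim : ∀ x {y} → T (x ∨ y) → T x ⊎ T y
T-∨-elim true  t = inj₁ t
T-∨-elim false t = inj₂ t

holds : ∀ {x} → x ≡ true → T x
holds refl = _

fails : ∀ {x} → x ≡ false → ¬ T x
fails refl ()

¬T-false : ∀ {x} → ¬ T x → x ≡ false
¬T-false {false} _ = refl
¬T-false {true} ¬t = ⊥-elim (¬t _)

T-ext : ∀ {x y} → (T x → T y) → (T y → T x) → x ≡ y
T-ext {false} {false} _ _ = refl
T-ext {false} {true}  _ g = ⊥-elim (g _)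
T-ext {true}  {false} f _ = ⊥-elim (f _)
T-ext {true}  {true}  _ _ = refl

==-refl : ∀ {n} (a : Fin n) → T (a == a)
==-refl a with a ≟ a
... | yes _ = _
... | no a≢a = a≢a refl

==-true : ∀ {n} {a b : Fin n} → a ≡ b → T (a == b)
==-true {a = a} refl = ==-refl a

==-sound : ∀ {n} {a b : Fin n} → T (a == b) → a ≡ b
==-sound {a = a} {b} t with a ≟ b
... | yes a≡b = a≡b

==-false : ∀ {n} {a b : Fin n} → a ≢ b → ¬ T (a == b)
==-false {a = a} {b} a≢b t with a ≟ b
... | yes a≡b = a≢b a≡b

allV-elim : ∀ {n} (p : Fin n → Bool) → T (allV p) → ∀ w → T (p w)
allV-elim {n} p t w = All.lookup (all⁺ p (allFin n) t) (∈-allFin w)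

allV-intro : ∀ {n} (p : Fin n → Bool) → (∀ w → T (p w)) → T (allV p)
allV-intro {n} p f = all⁻ p {allFin n} (All.tabulate (λ {w} _ → f w))

anyV-elim : ∀ {n} (p : Fin n → Bool) → T (anyV p) → ∃[ w ] T (p w)
anyV-elim {n} p t = satisfied (any⁻ p (allFin n) t)

anyV-intro : ∀ {n} (p : Fin n → Bool) w → T (p w) → T (anyV p)
anyV-intro {n} p w t = any⁺ p (lose (∈-allFin w) t)

module _ {n : ℕ} where

  _∈ₛ_ : Fin n → Subset n → Set
  w ∈ₛ W = T (lookup W w)

  Vertex : LGraph n → Fin n → Set
  Vertex H w = T (present H w)

  Edge : LGraph n → Fin n → Fin n → Set
  Edge H a b = T (ladj H a b)

  DominatedBy : LGraph n → Subset n → Fin n → Set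
  DominatedBy H W w = ∃[ w' ] w' ∈ₛ W × Edge H w w'

  Symmetric : LGraph n → Set
  Symmetric H = ∀ a b → ladj H a b ≡ ladj H b a

record IsIDS {n : ℕ} (H : LGraph n) (W : Subset n) : Set where
  field
    inside      : ∀ w → w ∈ₛ W → Vertex H w
    loopless    : ∀ w → w ∈ₛ W → ¬ Edge H w w
    independent : ∀ a b → a ∈ₛ W → b ∈ₛ W → a ≢ b → ¬ Edge H a b
    dominating  : ∀ w → Vertex H w → ¬ w ∈ₛ W → DominatedBy H W w

module _ {n : ℕ} (H : LGraph n) (W : Subset n) where

  insideC : Fin n → Bool
  insideC w = not (lookup W w) ∨ present H w
  looplessC : Fin n → Bool
  looplessC w = not (lookup W w) ∨ not (ladj H w w)
  independentC : Fin n → Fin n → Bool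
  independentC a b = not (lookup W a ∧ lookup W b ∧ not (a == b)) ∨ not (ladj H a b)
  dominatorC : Fin n → Fin n → Bool
  dominatorC w w' = lookup W w' ∧ not (w == w') ∧ ladj H w w'
  dominatingC : Fin n → Bool
  dominatingC w = not (present H w ∧ not (lookup W w)) ∨ anyV (dominatorC w)

  isIDS-sound : T (isIDS H W) → IsIDS H W
  isIDS-sound t = record
    { inside      = λ w → T-⇒-elim (allV-elim insideC insideT w)
    ; loopless    = λ w w∈W → T-not-elim (T-⇒-elim (allV-elim looplessC looplessT w) w∈W)
    ; independent = λ a b a∈W b∈W a≢b →
        T-not-elim (T-⇒-elim (allV-elim (independentC a) (allV-elim _ independentT a) b)
                     (T-∧-intro a∈W (T-∧-intro b∈W (T-not-intro (==-false a≢b)))))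
    ; dominating  = dominating }
    where
    insideT : T (allV insideC)
    insideT = T-∧-fst (allV insideC) t
    looplessT : T (allV looplessC)
    looplessT = T-∧-fst (allV looplessC) (T-∧-snd (allV insideC) t)
    independentT : T (allV (λ a → allV (independentC a)))
    independentT = T-∧-fst (allV (λ a → allV (independentC a))) (T-∧-snd (allV looplessC) (T-∧-snd (allV insideC) t))
    dominatingT : T (allV dominatingC)
    dominatingT = T-∧-snd (allV (λ a → allV (independentC a))) (T-∧-snd (allV looplessC) (T-∧-snd (allV insideC) t))
    dominating : ∀ w → Vertex H w → ¬ w ∈ₛ W → DominatedBy H W w
    dominating w w∈V w∉W
      with w' , t' ← anyV-elim (dominatorC w)
                       (T-⇒-elim (allV-elim dominatingC dominatingT w) (T-∧-intro w∈V (T-not-intro w∉W)))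
      = w' , T-∧-fst (lookup W w') t' , T-∧-snd (not (w == w')) (T-∧-snd (lookup W w') t')

  isIDS-complete : IsIDS H W → T (isIDS H W)
  isIDS-complete I =
    T-∧-intro (allV-intro insideC λ w → T-⇒-intro (inside w))
   (T-∧-intro (allV-intro looplessC λ w → T-⇒-intro λ w∈W → T-not-intro (loopless w w∈W))
   (T-∧-intro (allV-intro _ λ a → allV-intro (independentC a) λ b → T-⇒-intro (independentT a b))
              (allV-intro dominatingC λ w → T-⇒-intro λ t →
                 dominatingT w (T-∧-fst (present H w) t) (T-not-elim (T-∧-snd (present H w) t)))))
    where
    open IsIDS I
    independentT : ∀ a b → T (lookup W a ∧ lookup W b ∧ not (a == b)) → T (not (ladj H a b))
    independentT a b t = T-not-intro (independent a b a∈W b∈W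
                           λ a≡b → T-not-elim (T-∧-snd (lookup W b) (T-∧-snd (lookup W a) t)) (==-true a≡b))
      where
      a∈W = T-∧-fst (lookup W a) t
      b∈W = T-∧-fst (lookup W b) (T-∧-snd (lookup W a) t)
    dominatingT : ∀ w → Vertex H w → ¬ w ∈ₛ W → T (anyV (dominatorC w))
    dominatingT w w∈V w∉W with w' , w'∈W , ww' ← dominating w w∈V w∉W =
      anyV-intro (dominatorC w) w'
        (T-∧-intro w'∈W (T-∧-intro (T-not-intro (λ t → w∉W (subst (_∈ₛ W) (sym (==-sound t)) w'∈W))) ww'))

module _ {n : ℕ} where

  _∖_ : Subset n → Fin n → Subset n
  W ∖ x = W [ x ]≔ false

  ∖-removes : ∀ W x → ¬ x ∈ₛ (W ∖ x)
  ∖-removes W x t rewrite lookup∘update x W false = t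

  ∖-keeps : ∀ W {x w} → w ≢ x → lookup (W ∖ x) w ≡ lookup W w
  ∖-keeps W w≢x = lookup∘update′ w≢x W false

  ∖-⊆ : ∀ W x w → w ∈ₛ (W ∖ x) → w ∈ₛ W × w ≢ x
  ∖-⊆ W x w t with w ≟ x
  ... | yes refl = ⊥-elim (∖-removes W x t)
  ... | no w≢x = subst T (∖-keeps W w≢x) t , w≢x

  ∖-∈ : ∀ W x w → w ∈ₛ W → w ≢ x → w ∈ₛ (W ∖ x)
  ∖-∈ W x w t w≢x = subst T (sym (∖-keeps W w≢x)) t

module _ {n : ℕ} {H H' : LGraph n} {W : Subset n}
         (same-vertices : ∀ w → present H w ≡ present H' w)
         (same-edges : ∀ a b → b ∈ₛ W → ladj H a b ≡ ladj H' a b) where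

  transfer : IsIDS H W → IsIDS H' W
  transfer I = record
    { inside      = λ w w∈W → subst T (same-vertices w) (inside w w∈W)
    ; loopless    = λ w w∈W e → loopless w w∈W (subst T (sym (same-edges w w w∈W)) e)
    ; independent = λ a b a∈W b∈W a≢b e → independent a b a∈W b∈W a≢b (subst T (sym (same-edges a b b∈W)) e)
    ; dominating  = dominating′ }
    where
    open IsIDS I
    dominating′ : ∀ w → Vertex H' w → ¬ w ∈ₛ W → DominatedBy H' W w
    dominating′ w w∈V w∉W with w' , w'∈W , ww' ← dominating w (subst T (sym (same-vertices w)) w∈V) w∉W =
      w' , w'∈W , subst T (same-edges w w' w'∈W) ww'

module _ {n : ℕ} (H H' : LGraph n) (W : Subset n) where

  isIDS-agree : (∀ w → present H w ≡ present H' w) → (∀ a b → b ∈ₛ W → ladj H a b ≡ ladj H' a b) →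
                isIDS H W ≡ isIDS H' W
  isIDS-agree vs es = T-ext (λ t → isIDS-complete H' W (transfer vs es (isIDS-sound H W t)))
                            (λ t → isIDS-complete H W (transfer (λ w → sym (vs w)) (λ a b b∈W → sym (es a b b∈W))
                                                                 (isIDS-sound H' W t)))

-- Changing the edges at a single vertex z ∉ W (leaving the vertex set alone) can only
-- affect whether z itself is dominated.
module _ {n : ℕ} {H H' : LGraph n} {W : Subset n} (z : Fin n) (z∉W : ¬ z ∈ₛ W)
         (same-vertices : ∀ w → present H w ≡ present H' w)
         (same-edges : ∀ a b → b ∈ₛ W → a ≢ z → ladj H a b ≡ ladj H' a b) where

  transfer-except : DominatedBy H' W z → IsIDS H W → IsIDS H' W
  transfer-except z-dominated I = record
    { inside      = λ w w∈W → subst T (same-vertices w) (inside w w∈W)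
    ; loopless    = λ w w∈W e → loopless w w∈W (subst T (sym (same-edges w w w∈W (member≢z w∈W))) e)
    ; independent = λ a b a∈W b∈W a≢b e →
        independent a b a∈W b∈W a≢b (subst T (sym (same-edges a b b∈W (member≢z a∈W))) e)
    ; dominating  = dominating′ }
    where
    open IsIDS I
    member≢z : ∀ {w} → w ∈ₛ W → w ≢ z
    member≢z w∈W refl = z∉W w∈W
    dominating′ : ∀ w → Vertex H' w → ¬ w ∈ₛ W → DominatedBy H' W w
    dominating′ w w∈V w∉W with w ≟ z
    ... | yes refl = z-dominated
    ... | no w≢z with w' , w'∈W , ww' ← dominating w (subst T (sym (same-vertices w)) w∈V) w∉W =
      w' , w'∈W , subst T (same-edges w w' w'∈W w≢z) ww'

isDominated : ∀ {n} → LGraph n → Subset n → Fin n → Bool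
isDominated H W z = anyV (λ w → lookup W w ∧ ladj H z w)

dominated-isDominated : ∀ {n} (H : LGraph n) W z → DominatedBy H W z → T (isDominated H W z)
dominated-isDominated H W z (w , w∈W , zw) = anyV-intro (λ w → lookup W w ∧ ladj H z w) w (T-∧-intro w∈W zw)

isDominated-dominated : ∀ {n} (H : LGraph n) W z → T (isDominated H W z) → DominatedBy H W z
isDominated-dominated H W z t = let w , t′ = anyV-elim (λ w → lookup W w ∧ ladj H z w) t
                                in w , T-∧-fst (lookup W w) t′ , T-∧-snd (lookup W w) t′

module _ {n : ℕ} (H H' : LGraph n) (W : Subset n) (z : Fin n) (z∉W : ¬ z ∈ₛ W) (z∈V : Vertex H' z)
         (same-vertices : ∀ w → present H w ≡ present H' w)
         (same-edges : ∀ a b → b ∈ₛ W → a ≢ z → ladj H a b ≡ ladj H' a b) where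

  isIDS-except : DominatedBy H W z → isIDS H' W ≡ isIDS H W ∧ isDominated H' W z
  isIDS-except z-dominated = T-ext
    (λ t → let I' = isIDS-sound H' W t in
      T-∧-intro (isIDS-complete H W (transfer-except z z∉W (λ w → sym (same-vertices w))
                                       (λ a b b∈W a≢z → sym (same-edges a b b∈W a≢z)) z-dominated I'))
                (dominated-isDominated H' W z (IsIDS.dominating I' z z∈V z∉W)))
    (λ t → isIDS-complete H' W
      (transfer-except z z∉W same-vertices same-edges
        (isDominated-dominated H' W z (T-∧-snd (isIDS H W) t)) (isIDS-sound H W (T-∧-fst (isIDS H W) t))))

isIDS-avoids : ∀ {n} (H : LGraph n) W x → ¬ Vertex H x → T (isIDS H W) → ¬ x ∈ₛ W
isIDS-avoids H W x x∉V t x∈W = x∉V (IsIDS.inside (isIDS-sound H W t) x x∈W)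

isIDS-non-vertex : ∀ {n} (H : LGraph n) W x → x ∈ₛ W → ¬ Vertex H x → isIDS H W ≡ false
isIDS-non-vertex H W x x∈W x∉V = ¬T-false (λ t → isIDS-avoids H W x x∉V t x∈W)

module _ {n : ℕ} (H : LGraph n) (x : Fin n) where

  nbhd-deleted-vertex : ∀ w → Vertex (deleteClosedNbhd H x) w → Vertex H w × w ≢ x × ¬ Edge H x w
  nbhd-deleted-vertex w t with present H w | w ≟ x | ladj H x w
  ... | true | no w≢x | false = _ , w≢x , λ ()

  nbhd-deleted-vertex-intro : ∀ w → Vertex H w → w ≢ x → ¬ Edge H x w → Vertex (deleteClosedNbhd H x) w
  nbhd-deleted-vertex-intro w w∈V w≢x ¬xw with present H w | w ≟ x | ladj H x w
  ... | true | no _ | false = _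
  ... | true | yes w≡x | _ = w≢x w≡x
  ... | true | no _ | true = ¬xw _

module _ {n : ℕ} (H : LGraph n) (H-sym : Symmetric H) (W : Subset n) (x : Fin n) (x∈W : x ∈ₛ W) where

  private
    H⁻ = deleteClosedNbhd H x
    W⁻ = W ∖ x

    flip : ∀ {a b} → Edge H a b → Edge H b a
    flip {a} {b} = subst T (H-sym a b)

  peel-forward : IsIDS H W → IsIDS H⁻ W⁻
  peel-forward I = record
    { inside      = inside′
    ; loopless    = λ w w∈W⁻ → loopless w (proj₁ (∖-⊆ W x w w∈W⁻))
    ; independent = λ a b a∈W⁻ b∈W⁻ →
                      independent a b (proj₁ (∖-⊆ W x a a∈W⁻)) (proj₁ (∖-⊆ W x b b∈W⁻))
    ; dominating  = dominating′ }
    where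
    open IsIDS I
    inside′ : ∀ w → w ∈ₛ W⁻ → Vertex H⁻ w
    inside′ w w∈W⁻ with w∈W , w≢x ← ∖-⊆ W x w w∈W⁻ =
      nbhd-deleted-vertex-intro H x w (inside w w∈W) w≢x
        (independent x w x∈W w∈W (λ x≡w → w≢x (sym x≡w)))
    dominating′ : ∀ w → Vertex H⁻ w → ¬ w ∈ₛ W⁻ → DominatedBy H⁻ W⁻ w
    dominating′ w w∈V⁻ w∉W⁻
      with w∈V , w≢x , ¬xw ← nbhd-deleted-vertex H x w w∈V⁻
      with w' , w'∈W , ww' ← dominating w w∈V (λ w∈W → w∉W⁻ (∖-∈ W x w w∈W w≢x))
      = w' , ∖-∈ W x w' w'∈W (λ { refl → ¬xw (flip ww') }) , ww'

  peel-backward : Vertex H x → ¬ Edge H x x → IsIDS H⁻ W⁻ → IsIDS H W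
  peel-backward x∈V ¬xx I = record
    { inside      = inside′
    ; loopless    = loopless′
    ; independent = independent′
    ; dominating  = dominating′ }
    where
    open IsIDS I
    away : ∀ w → w ∈ₛ W → w ≢ x → ¬ Edge H x w
    away w w∈W w≢x = let _ , _ , ¬xw = nbhd-deleted-vertex H x w (inside w (∖-∈ W x w w∈W w≢x)) in ¬xw
    inside′ : ∀ w → w ∈ₛ W → Vertex H w
    inside′ w w∈W with w ≟ x
    ... | yes refl = x∈V
    ... | no w≢x = proj₁ (nbhd-deleted-vertex H x w (inside w (∖-∈ W x w w∈W w≢x)))
    loopless′ : ∀ w → w ∈ₛ W → ¬ Edge H w w
    loopless′ w w∈W with w ≟ x
    ... | yes refl = ¬xx
    ... | no w≢x = loopless w (∖-∈ W x w w∈W w≢x)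
    independent′ : ∀ a b → a ∈ₛ W → b ∈ₛ W → a ≢ b → ¬ Edge H a b
    independent′ a b a∈W b∈W a≢b with a ≟ x | b ≟ x
    ... | yes refl | _ = away b b∈W (λ b≡a → a≢b (sym b≡a))
    ... | no _ | yes refl = λ ab → away a a∈W a≢b (flip ab)
    ... | no a≢x | no b≢x = independent a b (∖-∈ W x a a∈W a≢x) (∖-∈ W x b b∈W b≢x) a≢b
    outside : ∀ {w} → ¬ w ∈ₛ W → w ≢ x
    outside w∉W refl = w∉W x∈W
    dominating′ : ∀ w → Vertex H w → ¬ w ∈ₛ W → DominatedBy H W w
    dominating′ w w∈V w∉W with T? (ladj H x w)
    ... | yes xw = x , x∈W , flip xw
    ... | no ¬xw with w' , w'∈W⁻ , ww' ← dominating w (nbhd-deleted-vertex-intro H x w w∈V (outside w∉W) ¬xw)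
                                                     (λ w∈W⁻ → w∉W (proj₁ (∖-⊆ W x w w∈W⁻)))
      = w' , proj₁ (∖-⊆ W x w' w'∈W⁻) , ww'

  peel : Vertex H x → ¬ Edge H x x → isIDS H W ≡ isIDS H⁻ W⁻
  peel x∈V ¬xx = T-ext (λ t → isIDS-complete H⁻ W⁻ (peel-forward (isIDS-sound H W t)))
                       (λ t → isIDS-complete H W (peel-backward x∈V ¬xx (isIDS-sound H⁻ W⁻ t)))

deleteClosedNbhd2-vertex : ∀ {n} (H : LGraph n) x y w →
  present (deleteClosedNbhd2 H x y) w ≡ present (deleteClosedNbhd (deleteClosedNbhd H x) y) w
deleteClosedNbhd2-vertex H x y w = sequential (present H w) ((w == x) ∨ ladj H x w) ((w == y) ∨ ladj H y w)
  where
  sequential : ∀ p a b → p ∧ not ((p ∧ a) ∨ (p ∧ b)) ≡ (p ∧ not (p ∧ a)) ∧ not ((p ∧ not (p ∧ a)) ∧ b)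
  sequential false _     _     = refl
  sequential true  false false = refl
  sequential true  false true  = refl
  sequential true  true  _     = refl

module _ {n : ℕ} (H H' : LGraph n) (x y : Fin n)
         (same-vertices : ∀ w → present H w ≡ present H' w)
         (same-edges : ∀ w → w ≢ x → w ≢ y → ladj H x w ≡ ladj H' x w × ladj H y w ≡ ladj H' y w) where

  twice-deleted-vertex : ∀ w → Vertex (deleteClosedNbhd (deleteClosedNbhd H x) y) w →
                               Vertex (deleteClosedNbhd (deleteClosedNbhd H' x) y) w
  twice-deleted-vertex w t
    with w∈V₁ , w≢y , ¬yw ← nbhd-deleted-vertex (deleteClosedNbhd H x) y w t
    with w∈V , w≢x , ¬xw ← nbhd-deleted-vertex H x w w∈V₁
    with xw≡ , yw≡ ← same-edges w w≢x w≢y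
    = nbhd-deleted-vertex-intro (deleteClosedNbhd H' x) y w
        (nbhd-deleted-vertex-intro H' x w (subst T (same-vertices w) w∈V) w≢x (λ e → ¬xw (subst T (sym xw≡) e)))
        w≢y (λ e → ¬yw (subst T (sym yw≡) e))

module _ {n : ℕ} where

  addLoops : LGraph n → (Fin n → Bool) → LGraph n
  addLoops H L = lgraph (present H) (λ a b → ladj H a b ∨ ((a == b) ∧ L a))

  meets : Subset n → (Fin n → Bool) → Bool
  meets W L = anyV (λ w → lookup W w ∧ L w)

module _ {n : ℕ} (H : LGraph n) (L : Fin n → Bool) (W : Subset n) where

  private
    H° = addLoops H L

  addLoops-forward : IsIDS H° W → IsIDS H W × ¬ T (meets W L)
  addLoops-forward I =
    record { inside      = inside
           ; loopless    = λ w w∈W e → loopless w w∈W (T-∨-inl e)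
           ; independent = λ a b a∈W b∈W a≢b e → independent a b a∈W b∈W a≢b (T-∨-inl e)
           ; dominating  = dominating′ }
    , λ t → let w , t′ = anyV-elim (λ w → lookup W w ∧ L w) t
            in loopless w (T-∧-fst (lookup W w) t′)
                 (T-∨-inr (ladj H w w) (T-∧-intro (==-refl w) (T-∧-snd (lookup W w) t′)))
    where
    open IsIDS I
    dominating′ : ∀ w → Vertex H w → ¬ w ∈ₛ W → DominatedBy H W w
    dominating′ w w∈V w∉W with w' , w'∈W , ww' ← dominating w w∈V w∉W
      with T-∨-elim (ladj H w w') ww'
    ... | inj₁ e = w' , w'∈W , e
    ... | inj₂ t = ⊥-elim (w∉W (subst (_∈ₛ W) (sym (==-sound (T-∧-fst (w == w') t))) w'∈W))

  addLoops-backward : IsIDS H W → ¬ T (meets W L) → IsIDS H° W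
  addLoops-backward I ¬meets = record
    { inside      = inside
    ; loopless    = loopless′
    ; independent = independent′
    ; dominating  = λ w w∈V w∉W → let w' , w'∈W , ww' = dominating w w∈V w∉W in w' , w'∈W , T-∨-inl ww' }
    where
    open IsIDS I
    loopless′ : ∀ w → w ∈ₛ W → ¬ Edge H° w w
    loopless′ w w∈W e with T-∨-elim (ladj H w w) e
    ... | inj₁ ww = loopless w w∈W ww
    ... | inj₂ t  = ¬meets (anyV-intro (λ w → lookup W w ∧ L w) w (T-∧-intro w∈W (T-∧-snd (w == w) t)))
    independent′ : ∀ a b → a ∈ₛ W → b ∈ₛ W → a ≢ b → ¬ Edge H° a b
    independent′ a b a∈W b∈W a≢b e with T-∨-elim (ladj H a b) e
    ... | inj₁ ab = independent a b a∈W b∈W a≢b ab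
    ... | inj₂ t  = a≢b (==-sound (T-∧-fst (a == b) t))

  addLoops-isIDS : isIDS H° W ≡ isIDS H W ∧ not (meets W L)
  addLoops-isIDS = T-ext
    (λ t → let I , ¬m = addLoops-forward (isIDS-sound H° W t)
           in T-∧-intro (isIDS-complete H W I) (T-not-intro ¬m))
    (λ t → isIDS-complete H° W (addLoops-backward (isIDS-sound H W (T-∧-fst (isIDS H W) t))
                                                  (T-not-elim (T-∧-snd (isIDS H W) t))))

module _ {n : ℕ} (H : LGraph n) (u v : Fin n) where

  private
    Hₑ = deleteEdge H u v

  removed : Fin n → Fin n → Bool
  removed a b = ((a == u) ∧ (b == v)) ∨ ((a == v) ∧ (b == u))

  deleteEdge-other : ∀ a b → ¬ (a ≡ u × b ≡ v) → ¬ (a ≡ v × b ≡ u) → ladj Hₑ a b ≡ ladj H a b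
  deleteEdge-other a b ¬uv ¬vu = begin
    ladj H a b ∧ not (removed a b) ≡⟨ cong (λ r → ladj H a b ∧ not r) (¬T-false ¬removed) ⟩
    ladj H a b ∧ true              ≡⟨ ∧-identityʳ (ladj H a b) ⟩
    ladj H a b                     ∎
    where
    open ≡-Reasoning
    ¬removed : ¬ T (removed a b)
    ¬removed t with T-∨-elim ((a == u) ∧ (b == v)) t
    ... | inj₁ t₁ = ¬uv (==-sound (T-∧-fst (a == u) t₁) , ==-sound (T-∧-snd (a == u) t₁))
    ... | inj₂ t₂ = ¬vu (==-sound (T-∧-fst (a == v) t₂) , ==-sound (T-∧-snd (a == v) t₂))

  deleteEdge-uv : ¬ Edge Hₑ u v
  deleteEdge-uv t = T-not-elim {removed u v} (T-∧-snd (ladj H u v) t)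
                      (T-∨-inl {(u == u) ∧ (v == v)} (T-∧-intro {u == u} (==-refl u) (==-refl v)))

  deleteEdge-vu : ¬ Edge Hₑ v u
  deleteEdge-vu t = T-not-elim {removed v u} (T-∧-snd (ladj H v u) t)
                      (T-∨-inr ((v == u) ∧ (u == v)) (T-∧-intro {v == v} (==-refl v) (==-refl u)))

  deleteEdge-sym : Symmetric H → Symmetric Hₑ
  deleteEdge-sym H-sym a b = cong₂ (λ e r → e ∧ not r) (H-sym a b) removed-sym
    where
    removed-sym : removed a b ≡ removed b a
    removed-sym = trans (∨-comm ((a == u) ∧ (b == v)) _) (cong₂ _∨_ (∧-comm (a == v) _) (∧-comm (a == u) _))

  deleteEdge-swap : ∀ a b → ladj Hₑ a b ≡ ladj (deleteEdge H v u) a b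
  deleteEdge-swap a b = cong (λ r → ladj H a b ∧ not r) (∨-comm ((a == u) ∧ (b == v)) _)

𝟙 : Bool → ℕ
𝟙 true  = 1
𝟙 false = 0

countL : {A : Set} → (A → Bool) → List A → ℕ
countL p xs = length (filter (λ x → T? (p x)) xs)

countL-∷ : ∀ {A : Set} (p : A → Bool) x xs → countL p (x ∷ xs) ≡ 𝟙 (p x) + countL p xs
countL-∷ p x xs with p x
... | true  = refl
... | false = refl

countL-++ : ∀ {A : Set} (p : A → Bool) xs ys → countL p (xs ++ ys) ≡ countL p xs + countL p ys
countL-++ p xs ys = begin
  length (filter P? (xs ++ ys))                  ≡⟨ cong length (filter-++ P? xs ys) ⟩
  length (filter P? xs ++ filter P? ys)          ≡⟨ length-++ (filter P? xs) ⟩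
  length (filter P? xs) + length (filter P? ys)  ∎
  where
  open ≡-Reasoning
  P? = λ x → T? (p x)

countL-map : ∀ {A B : Set} (p : B → Bool) (f : A → B) xs → countL p (map f xs) ≡ countL (λ x → p (f x)) xs
countL-map p f []       = refl
countL-map p f (x ∷ xs) = begin
  countL p (f x ∷ map f xs)                    ≡⟨ countL-∷ p (f x) (map f xs) ⟩
  𝟙 (p (f x)) + countL p (map f xs)            ≡⟨ cong (λ m → 𝟙 (p (f x)) + m) (countL-map p f xs) ⟩
  𝟙 (p (f x)) + countL (λ x → p (f x)) xs      ≡⟨ countL-∷ (λ x → p (f x)) x xs ⟨
  countL (λ x → p (f x)) (x ∷ xs)              ∎
  where open ≡-Reasoning

countL-cong : ∀ {A : Set} {p q : A → Bool} → (∀ x → p x ≡ q x) → ∀ xs → countL p xs ≡ countL q xs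
countL-cong p≗q []       = refl
countL-cong {p = p} {q} p≗q (x ∷ xs) = begin
  countL p (x ∷ xs)        ≡⟨ countL-∷ p x xs ⟩
  𝟙 (p x) + countL p xs    ≡⟨ cong₂ _+_ (cong 𝟙 (p≗q x)) (countL-cong p≗q xs) ⟩
  𝟙 (q x) + countL q xs    ≡⟨ countL-∷ q x xs ⟨
  countL q (x ∷ xs)        ∎
  where open ≡-Reasoning

countL-additive : ∀ {A : Set} (p₁ p₂ q₁ q₂ q₃ : A → Bool) →
  (∀ x → 𝟙 (p₁ x) + 𝟙 (p₂ x) ≡ 𝟙 (q₁ x) + 𝟙 (q₂ x) + 𝟙 (q₃ x)) → ∀ xs →
  countL p₁ xs + countL p₂ xs ≡ countL q₁ xs + countL q₂ xs + countL q₃ xs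
countL-additive p₁ p₂ q₁ q₂ q₃ pointwise []       = refl
countL-additive p₁ p₂ q₁ q₂ q₃ pointwise (x ∷ xs)
  rewrite countL-∷ p₁ x xs | countL-∷ p₂ x xs | countL-∷ q₁ x xs | countL-∷ q₂ x xs | countL-∷ q₃ x xs =
  regroup (𝟙 (p₁ x)) (𝟙 (p₂ x)) (𝟙 (q₁ x)) (𝟙 (q₂ x)) (𝟙 (q₃ x)) _ _ _ _ _
          (pointwise x) (countL-additive p₁ p₂ q₁ q₂ q₃ pointwise xs)
  where
  regroup : ∀ a b c d e A B C D E → a + b ≡ c + d + e → A + B ≡ C + D + E →
            (a + A) + (b + B) ≡ (c + C) + (d + D) + (e + E)
  regroup a b c d e A B C D E h₁ h₂ = begin
    (a + A) + (b + B)              ≡⟨ swap-middle a A b B ⟩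
    (a + b) + (A + B)              ≡⟨ cong₂ _+_ h₁ h₂ ⟩
    (c + d + e) + (C + D + E)      ≡⟨ interleave c d e C D E ⟩
    (c + C) + (d + D) + (e + E)    ∎
    where
    open ≡-Reasoning
    swap-middle : ∀ a A b B → (a + A) + (b + B) ≡ (a + b) + (A + B)
    swap-middle = solve-∀
    interleave : ∀ c d e C D E → (c + d + e) + (C + D + E) ≡ (c + C) + (d + D) + (e + E)
    interleave = solve-∀

module _ {n : ℕ} where

  count : (Subset n → Bool) → ℕ
  count p = countL p (allSubsets n)

  count-cong : ∀ {p q : Subset n → Bool} → (∀ W → p W ≡ q W) → count p ≡ count q
  count-cong p≗q = countL-cong p≗q (allSubsets n)

count-split : ∀ {n} (p : Subset (suc n) → Bool) →
  count p ≡ count (λ W → p (true ∷ W)) + count (λ W → p (false ∷ W))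
count-split {n} p = begin
  countL p (map (true ∷_) (allSubsets n) ++ map (false ∷_) (allSubsets n))
    ≡⟨ countL-++ p (map (true ∷_) (allSubsets n)) _ ⟩
  countL p (map (true ∷_) (allSubsets n)) + countL p (map (false ∷_) (allSubsets n))
    ≡⟨ cong₂ _+_ (countL-map p (true ∷_) (allSubsets n)) (countL-map p (false ∷_) (allSubsets n)) ⟩
  count (λ W → p (true ∷ W)) + count (λ W → p (false ∷ W)) ∎
  where open ≡-Reasoning

-- choosing W ∋ u and keeping W ∖ u is a bijection onto the subsets avoiding u
count-remove : ∀ {n} (u : Fin n) (r : Subset n → Bool) →
  count (λ W → lookup W u ∧ r (W ∖ u)) ≡ count (λ W → not (lookup W u) ∧ r W)
count-remove {suc n} zero r = begin
  count (λ W → lookup W zero ∧ r (W ∖ zero))              ≡⟨ count-split (λ W → lookup W zero ∧ r (W ∖ zero)) ⟩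
  count (λ W → r (false ∷ W)) + count {n} (λ _ → false)   ≡⟨ +-comm (count (λ W → r (false ∷ W))) _ ⟩
  count {n} (λ _ → false) + count (λ W → r (false ∷ W))   ≡⟨ count-split (λ W → not (lookup W zero) ∧ r W) ⟨
  count (λ W → not (lookup W zero) ∧ r W)                 ∎
  where open ≡-Reasoning
count-remove {suc n} (suc u) r = begin
  count (λ W → lookup W (suc u) ∧ r (W ∖ suc u))
    ≡⟨ count-split (λ W → lookup W (suc u) ∧ r (W ∖ suc u)) ⟩
  count (λ W → lookup W u ∧ r (true ∷ W ∖ u)) + count (λ W → lookup W u ∧ r (false ∷ W ∖ u))
    ≡⟨ cong₂ _+_ (count-remove u (λ W → r (true ∷ W))) (count-remove u (λ W → r (false ∷ W))) ⟩
  count (λ W → not (lookup W u) ∧ r (true ∷ W)) + count (λ W → not (lookup W u) ∧ r (false ∷ W))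
    ≡⟨ count-split (λ W → not (lookup W (suc u)) ∧ r W) ⟨
  count (λ W → not (lookup W (suc u)) ∧ r W) ∎
  where open ≡-Reasoning

count-none : ∀ {n} → count {n} (λ _ → false) ≡ 0
count-none {n} = none (allSubsets n)
  where
  none : ∀ xs → countL {Subset n} (λ _ → false) xs ≡ 0
  none []       = refl
  none (_ ∷ xs) = none xs

∣∖∣ : ∀ {n} (W : Subset n) x → x ∈ₛ W → ∣ W ∣ ≡ suc ∣ W ∖ x ∣
∣∖∣ (true  ∷ W) zero    _   = refl
∣∖∣ (true  ∷ W) (suc x) x∈W = cong suc (∣∖∣ W x x∈W)
∣∖∣ (false ∷ W) (suc x) x∈W = ∣∖∣ W x x∈W

≟-suc : ∀ m k → ⌊ suc m ℕ.≟ suc k ⌋ ≡ ⌊ m ℕ.≟ k ⌋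
≟-suc m k = begin
  ⌊ suc m ℕ.≟ suc k ⌋    ≡⟨ isYes≗does (suc m ℕ.≟ suc k) ⟩
  does (suc m ℕ.≟ suc k) ≡⟨ does-⇔ (mk⇔ suc-injective (cong suc)) (suc m ℕ.≟ suc k) (m ℕ.≟ k) ⟩
  does (m ℕ.≟ k)         ≡⟨ isYes≗does (m ℕ.≟ k) ⟨
  ⌊ m ℕ.≟ k ⌋            ∎
  where open ≡-Reasoning

module _ {n : ℕ} where

  hasSize : Subset n → ℕ → Bool
  hasSize W k = ⌊ ∣ W ∣ ℕ.≟ k ⌋

  -- the coefficient of x^k in the generating polynomial of the subsets satisfying r;
  -- ID H is by definition the generating polynomial of isIDS H
  coeff : (Subset n → Bool) → ℕ → ℕ
  coeff r k = count (λ W → r W ∧ hasSize W k)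

  -- adjoining a fixed vertex u to sets avoiding u multiplies the generating polynomial by x
  module _ (u : Fin n) (r : Subset n → Bool) (r-avoids-u : ∀ W → T (r W) → ¬ u ∈ₛ W) where

    coeff-adjoin-zero : coeff (λ W → lookup W u ∧ r (W ∖ u)) zero ≡ 0
    coeff-adjoin-zero = trans (count-cong too-big) (count-none {n})
      where
      too-big : ∀ W → ((lookup W u ∧ r (W ∖ u)) ∧ hasSize W zero) ≡ false
      too-big W with lookup W u in u∈W
      ... | false = refl
      ... | true rewrite ∣∖∣ W u (subst T (sym u∈W) _) = ∧-zeroʳ (r (W ∖ u))

    coeff-adjoin-suc : ∀ k → coeff (λ W → lookup W u ∧ r (W ∖ u)) (suc k) ≡ coeff r k
    coeff-adjoin-suc k = begin
      count (λ W → (lookup W u ∧ r (W ∖ u)) ∧ hasSize W (suc k))  ≡⟨ count-cong shrink ⟩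
      count (λ W → lookup W u ∧ (r (W ∖ u) ∧ hasSize (W ∖ u) k)) ≡⟨ count-remove u (λ W → r W ∧ hasSize W k) ⟩
      count (λ W → not (lookup W u) ∧ (r W ∧ hasSize W k))       ≡⟨ count-cong avoid ⟩
      count (λ W → r W ∧ hasSize W k)                             ∎
      where
      open ≡-Reasoning
      shrink : ∀ W → ((lookup W u ∧ r (W ∖ u)) ∧ hasSize W (suc k)) ≡
                     (lookup W u ∧ (r (W ∖ u) ∧ hasSize (W ∖ u) k))
      shrink W with lookup W u in u∈W
      ... | false = refl
      ... | true rewrite ∣∖∣ W u (subst T (sym u∈W) _) = cong (r (W ∖ u) ∧_) (≟-suc ∣ W ∖ u ∣ k)
      avoid : ∀ W → (not (lookup W u) ∧ (r W ∧ hasSize W k)) ≡ (r W ∧ hasSize W k)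
      avoid W with r W in rW
      ... | false = ∧-zeroʳ (not (lookup W u))
      ... | true with lookup W u in u∈W
      ...   | true  = ⊥-elim (r-avoids-u W (subst T (sym rW) _) (subst T (sym u∈W) _))
      ...   | false = refl

    X-adjoin : ∀ k → (X^ 1 · (λ j → ℤ.+ coeff r j)) k ≡ ℤ.+ coeff (λ W → lookup W u ∧ r (W ∖ u)) k
    X-adjoin zero    = sym (cong ℤ.+_ coeff-adjoin-zero)
    X-adjoin (suc k) = sym (cong ℤ.+_ (coeff-adjoin-suc k))

  coeff-additive : ∀ (p₁ p₂ q₁ q₂ q₃ : Subset n → Bool) →
    (∀ W → 𝟙 (p₁ W) + 𝟙 (p₂ W) ≡ 𝟙 (q₁ W) + 𝟙 (q₂ W) + 𝟙 (q₃ W)) → ∀ k →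
    coeff p₁ k + coeff p₂ k ≡ coeff q₁ k + coeff q₂ k + coeff q₃ k
  coeff-additive p₁ p₂ q₁ q₂ q₃ pointwise k =
    countL-additive (sized p₁) (sized p₂) (sized q₁) (sized q₂) (sized q₃) sized-pointwise (allSubsets n)
    where
    sized : (Subset n → Bool) → Subset n → Bool
    sized p W = p W ∧ hasSize W k
    sized-pointwise : ∀ W →
      𝟙 (sized p₁ W) + 𝟙 (sized p₂ W) ≡ 𝟙 (sized q₁ W) + 𝟙 (sized q₂ W) + 𝟙 (sized q₃ W)
    sized-pointwise W with hasSize W k
    ... | true  rewrite ∧-identityʳ (p₁ W) | ∧-identityʳ (p₂ W) | ∧-identityʳ (q₁ W) | ∧-identityʳ (q₂ W)
                      | ∧-identityʳ (q₃ W) = pointwise W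
    ... | false rewrite ∧-zeroʳ (p₁ W) | ∧-zeroʳ (p₂ W) | ∧-zeroʳ (q₁ W) | ∧-zeroʳ (q₂ W)
                      | ∧-zeroʳ (q₃ W) = refl

module EdgeGraphs {n : ℕ} (G : SimpleGraph n) (u v : Fin n) (uv : adj G u v ≡ true) where

  Gₗ : LGraph n
  Gₗ = toL G

  A : LGraph n
  A = deleteClosedNbhd (circ Gₗ v) u

  Gₗ-sym : Symmetric Gₗ
  Gₗ-sym = SimpleGraph.sym G

  Gₗ-loopless : ∀ a → ¬ Edge Gₗ a a
  Gₗ-loopless a e = subst T (irrfl G a) e

  u≢v : u ≢ v
  u≢v refl = Gₗ-loopless u (subst T (sym uv) _)

  edge-uv : Edge Gₗ u v
  edge-uv = subst T (sym uv) _

  -- G ∘ v - N[u] is G - N[u] with loops added at the neighbours of v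
  A-vertex : ∀ w → present A w ≡ present (deleteClosedNbhd Gₗ u) w
  A-vertex w with w ≟ v | w ≟ u | u ≟ w | adj G u w in uw
  ... | yes refl | yes refl | _       | _     = ⊥-elim (u≢v refl)
  ... | yes refl | no _     | _       | false = ⊥-elim (subst T (trans (sym uv) uw) _)
  ... | yes refl | no _     | _       | true  = refl
  ... | no _     | yes refl | _       | _     = refl
  ... | no _     | no w≢u   | yes u≡w | _     = ⊥-elim (w≢u (sym u≡w))
  ... | no _     | no _     | no _    | false = refl
  ... | no _     | no _     | no _    | true  = refl

  edge-vu : Edge Gₗ v u
  edge-vu = subst T (Gₗ-sym u v) edge-uv

  A-isIDS : ∀ W → isIDS A W ≡ isIDS (addLoops (deleteClosedNbhd Gₗ u) (adj G v)) W
  A-isIDS W = isIDS-agree A (addLoops (deleteClosedNbhd Gₗ u) (adj G v)) W A-vertex (λ _ _ _ → refl)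

  u∉A : ¬ Vertex A u
  u∉A t = proj₁ (proj₂ (nbhd-deleted-vertex Gₗ u u (subst T (A-vertex u) t))) refl

  v∉A : ¬ Vertex A v
  v∉A t = proj₂ (proj₂ (nbhd-deleted-vertex Gₗ u v (subst T (A-vertex v) t))) edge-uv

  G-e : LGraph n
  G-e = deleteEdge Gₗ u v

  G-e-sym : Symmetric G-e
  G-e-sym = deleteEdge-sym Gₗ u v Gₗ-sym

  G-e-edge : ∀ a b → b ≢ u → b ≢ v → ladj G-e a b ≡ adj G a b
  G-e-edge a b b≢u b≢v = deleteEdge-other Gₗ u v a b (λ (_ , b≡v) → b≢v b≡v) (λ (_ , b≡u) → b≢u b≡u)

  G-e-edge-v : ∀ b → b ≢ u → ladj G-e v b ≡ adj G v b
  G-e-edge-v b b≢u = deleteEdge-other Gₗ u v v b (λ (v≡u , _) → u≢v (sym v≡u)) (λ (_ , b≡u) → b≢u b≡u)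

  N₂ : LGraph n
  N₂ = deleteClosedNbhd2 Gₗ u v

  N₂-twice-deleted : ∀ w → present N₂ w ≡ present (deleteClosedNbhd (deleteClosedNbhd G-e u) v) w
  N₂-twice-deleted w = trans (deleteClosedNbhd2-vertex Gₗ u v w)
    (T-ext (twice-deleted-vertex Gₗ G-e u v (λ _ → refl) (λ w w≢u w≢v → sym (uw w≢u w≢v) , sym (vw w≢u w≢v)) w)
           (twice-deleted-vertex G-e Gₗ u v (λ _ → refl) (λ w w≢u w≢v → uw w≢u w≢v , vw w≢u w≢v) w))
    where
    uw : ∀ {w} → w ≢ u → w ≢ v → ladj G-e u w ≡ adj G u w
    uw {w} = G-e-edge u w
    vw : ∀ {w} → w ≢ u → w ≢ v → ladj G-e v w ≡ adj G v w
    vw {w} = G-e-edge v w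

  u∉N₂ : ¬ Vertex N₂ u
  u∉N₂ t with w∈V₁ , _ ← nbhd-deleted-vertex (deleteClosedNbhd Gₗ u) v u
                            (subst T (deleteClosedNbhd2-vertex Gₗ u v u) t)
    = proj₁ (proj₂ (nbhd-deleted-vertex Gₗ u u w∈V₁)) refl

  v∉N₂ : ¬ Vertex N₂ v
  v∉N₂ t = proj₁ (proj₂ (nbhd-deleted-vertex (deleteClosedNbhd Gₗ u) v v
                            (subst T (deleteClosedNbhd2-vertex Gₗ u v v) t))) refl

  -- neither u nor v in W: the edge uv is invisible to W
  neither : ∀ W → ¬ u ∈ₛ W → ¬ v ∈ₛ W → isIDS Gₗ W ≡ isIDS G-e W
  neither W u∉W v∉W = isIDS-agree Gₗ G-e W (λ _ → refl)
    (λ a b b∈W → sym (G-e-edge a b (λ { refl → u∉W b∈W }) (λ { refl → v∉W b∈W })))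

  module OnlyU (W : Subset n) (u∈W : u ∈ₛ W) (v∉W : ¬ v ∈ₛ W) where

    -- W dominates v in G - e: v has a neighbour in W other than u
    D : Bool
    D = isDominated G-e W v

    with-edge-deleted : isIDS G-e W ≡ isIDS Gₗ W ∧ D
    with-edge-deleted = isIDS-except Gₗ G-e W v v∉W _ (λ _ → refl)
      (λ a b b∈W a≢v → sym (deleteEdge-other Gₗ u v a b (λ (_ , b≡v) → v∉W (subst (_∈ₛ W) b≡v b∈W))
                                                         (λ (a≡v , _) → a≢v a≡v)))
      (u , u∈W , edge-vu)

    meets-D : meets (W ∖ u) (adj G v) ≡ D
    meets-D = T-ext
      (λ t → let w , t′ = anyV-elim (λ w → lookup (W ∖ u) w ∧ adj G v w) t
                 w∈W , w≢u = ∖-⊆ W u w (T-∧-fst (lookup (W ∖ u) w) t′)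
             in dominated-isDominated G-e W v
                  (w , w∈W , subst T (sym (G-e-edge-v w w≢u)) (T-∧-snd (lookup (W ∖ u) w) t′)))
      (λ t → let w , w∈W , vw = isDominated-dominated G-e W v t
                 w≢u = λ w≡u → deleteEdge-vu Gₗ u v (subst (Edge G-e v) w≡u vw)
             in anyV-intro (λ w → lookup (W ∖ u) w ∧ adj G v w) w
                  (T-∧-intro (∖-∈ W u w w∈W w≢u) (subst T (G-e-edge-v w w≢u) vw)))

    circ-deleted : isIDS A (W ∖ u) ≡ isIDS Gₗ W ∧ not D
    circ-deleted = begin
      isIDS A (W ∖ u)
        ≡⟨ A-isIDS (W ∖ u) ⟩
      isIDS (addLoops (deleteClosedNbhd Gₗ u) (adj G v)) (W ∖ u)
        ≡⟨ addLoops-isIDS (deleteClosedNbhd Gₗ u) (adj G v) (W ∖ u) ⟩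
      isIDS (deleteClosedNbhd Gₗ u) (W ∖ u) ∧ not (meets (W ∖ u) (adj G v))
        ≡⟨ cong₂ (λ p q → p ∧ not q) (sym (peel Gₗ Gₗ-sym W u u∈W _ (Gₗ-loopless u))) meets-D ⟩
      isIDS Gₗ W ∧ not D ∎
      where open ≡-Reasoning

  module Both (W : Subset n) (u∈W : u ∈ₛ W) (v∈W : v ∈ₛ W) where

    v∈W∖u : v ∈ₛ (W ∖ u)
    v∈W∖u = ∖-∈ W u v v∈W (λ v≡u → u≢v (sym v≡u))

    not-independent : isIDS Gₗ W ≡ false
    not-independent = ¬T-false (λ t → IsIDS.independent (isIDS-sound Gₗ W t) u v u∈W v∈W u≢v edge-uv)

    circ-deleted : isIDS A (W ∖ u) ≡ false
    circ-deleted = isIDS-non-vertex A (W ∖ u) v v∈W∖u v∉A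

    both-deleted : isIDS G-e W ≡ isIDS N₂ ((W ∖ u) ∖ v)
    both-deleted = begin
      isIDS G-e W
        ≡⟨ peel G-e G-e-sym W u u∈W _ (λ e → Gₗ-loopless u (T-∧-fst (adj G u u) e)) ⟩
      isIDS (deleteClosedNbhd G-e u) (W ∖ u)
        ≡⟨ peel (deleteClosedNbhd G-e u) G-e-sym (W ∖ u) v v∈W∖u
             (nbhd-deleted-vertex-intro G-e u v _ (λ v≡u → u≢v (sym v≡u)) (deleteEdge-uv Gₗ u v))
             (λ e → Gₗ-loopless v (T-∧-fst (adj G v v) e)) ⟩
      isIDS (deleteClosedNbhd (deleteClosedNbhd G-e u) v) ((W ∖ u) ∖ v)
        ≡⟨ isIDS-agree _ N₂ ((W ∖ u) ∖ v) (λ w → sym (N₂-twice-deleted w)) outside-uv ⟩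
      isIDS N₂ ((W ∖ u) ∖ v) ∎
      where
      open ≡-Reasoning
      outside-uv : ∀ a b → b ∈ₛ ((W ∖ u) ∖ v) → ladj G-e a b ≡ adj G a b
      outside-uv a b b∈W⁻⁻ = let b∈W⁻ , b≢v = ∖-⊆ (W ∖ u) v b b∈W⁻⁻
                                 _ , b≢u = ∖-⊆ W u b b∈W⁻
                             in G-e-edge a b b≢u b≢v

rearrange : ∀ a b c d e → a ℕ.+ c ≡ b ℕ.+ d ℕ.+ e → + a ≡ + b ℤ.- + c ℤ.+ + d ℤ.+ + e
rearrange a b c d e h = begin
  + a                                ≡⟨ add-sub (+ a) (+ c) ⟩
  + a ℤ.+ + c ℤ.- + c                ≡⟨ cong (ℤ._- + c) (pos-+ a c) ⟨
  + (a ℕ.+ c) ℤ.- + c                ≡⟨ cong (λ m → + m ℤ.- + c) h ⟩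
  + (b ℕ.+ d ℕ.+ e) ℤ.- + c          ≡⟨ cong (ℤ._- + c) (trans (pos-+ (b ℕ.+ d) e) (cong (ℤ._+ + e) (pos-+ b d))) ⟩
  + b ℤ.+ + d ℤ.+ + e ℤ.- + c        ≡⟨ move-sub (+ b) (+ c) (+ d) (+ e) ⟩
  + b ℤ.- + c ℤ.+ + d ℤ.+ + e        ∎
  where
  open ≡-Reasoning
  add-sub : ∀ x y → x ≡ x ℤ.+ y ℤ.- y
  add-sub = ℤ-Solver.solve-∀
  move-sub : ∀ x y z w → x ℤ.+ z ℤ.+ w ℤ.- y ≡ x ℤ.- y ℤ.+ z ℤ.+ w
  move-sub = ℤ-Solver.solve-∀

indicator-split : ∀ x d → 𝟙 x + 0 ≡ 𝟙 (x ∧ d) + 𝟙 (x ∧ not d) + 0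
indicator-split false _     = refl
indicator-split true  false = refl
indicator-split true  true  = refl

add-zeros : ∀ m → m ≡ m + 0 + 0
add-zeros m = sym (trans (+-identityʳ (m + 0)) (+-identityʳ m))

indicator-split′ : ∀ x d → 𝟙 x + 0 ≡ 𝟙 (x ∧ d) + 0 + 𝟙 (x ∧ not d)
indicator-split′ false _     = refl
indicator-split′ true  false = refl
indicator-split′ true  true  = refl

module Recurrence {n : ℕ} (G : SimpleGraph n) (u v : Fin n) (uv : adj G u v ≡ true) where

  open EdgeGraphs G u v uv public
  private
    module Reversed = EdgeGraphs G v u (trans (SimpleGraph.sym G v u) uv)

  B : LGraph n
  B = Reversed.A

  with-v-N₂ : Subset n → Bool
  with-v-N₂ W = lookup W v ∧ isIDS N₂ (W ∖ v)


  ids-G ids-G-e with-uv with-u with-v : Subset n → Bool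
  ids-G   W = isIDS Gₗ W
  ids-G-e W = isIDS G-e W
  with-uv W = lookup W u ∧ with-v-N₂ (W ∖ u)
  with-u  W = lookup W u ∧ isIDS A (W ∖ u)
  with-v  W = lookup W v ∧ isIDS B (W ∖ v)

  G-e-reversed : ∀ W → isIDS G-e W ≡ isIDS (deleteEdge Gₗ v u) W
  G-e-reversed W = isIDS-agree G-e (deleteEdge Gₗ v u) W (λ _ → refl) (λ a b _ → deleteEdge-swap Gₗ u v a b)

  open ≡-Reasoning

  pointwise : ∀ W → 𝟙 (ids-G W) + 𝟙 (with-uv W) ≡ 𝟙 (ids-G-e W) + 𝟙 (with-u W) + 𝟙 (with-v W)
  pointwise W rewrite ∖-keeps W {u} {v} (λ v≡u → u≢v (sym v≡u)) with lookup W u in eu | lookup W v in ev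
  ... | false | false = begin
    𝟙 (isIDS Gₗ W) + 0
      ≡⟨ cong (λ p → 𝟙 p + 0) (neither W (fails eu) (fails ev)) ⟩
    𝟙 (isIDS G-e W) + 0
      ≡⟨ +-identityʳ _ ⟨
    𝟙 (isIDS G-e W) + 0 + 0 ∎
  ... | true  | false = begin
    𝟙 (isIDS Gₗ W) + 0
      ≡⟨ indicator-split (isIDS Gₗ W) D ⟩
    𝟙 (isIDS Gₗ W ∧ D) + 𝟙 (isIDS Gₗ W ∧ not D) + 0
      ≡⟨ cong₂ (λ p q → 𝟙 p + 𝟙 q + 0) with-edge-deleted circ-deleted ⟨
    𝟙 (isIDS G-e W) + 𝟙 (isIDS A (W ∖ u)) + 0 ∎
    where open OnlyU W (holds eu) (fails ev)
  ... | false | true  = begin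
    𝟙 (isIDS Gₗ W) + 0
      ≡⟨ indicator-split′ (isIDS Gₗ W) D ⟩
    𝟙 (isIDS Gₗ W ∧ D) + 0 + 𝟙 (isIDS Gₗ W ∧ not D)
      ≡⟨ cong₂ (λ p q → 𝟙 p + 0 + 𝟙 q) (trans (G-e-reversed W) with-edge-deleted) circ-deleted ⟨
    𝟙 (isIDS G-e W) + 0 + 𝟙 (isIDS B (W ∖ v)) ∎
    where open Reversed.OnlyU W (holds ev) (fails eu)
  ... | true  | true  = begin
    𝟙 (isIDS Gₗ W) + 𝟙 (isIDS N₂ ((W ∖ u) ∖ v))
      ≡⟨ cong₂ (λ p q → 𝟙 p + 𝟙 q) not-independent (sym both-deleted) ⟩
    𝟙 false + 𝟙 (isIDS G-e W)
      ≡⟨ add-zeros (𝟙 (isIDS G-e W)) ⟩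
    𝟙 (isIDS G-e W) + 0 + 𝟙 false
      ≡⟨ cong₂ (λ p q → 𝟙 (isIDS G-e W) + 𝟙 p + 𝟙 q)
               circ-deleted (Reversed.Both.circ-deleted W (holds ev) (holds eu)) ⟨
    𝟙 (isIDS G-e W) + 𝟙 (isIDS A (W ∖ u)) + 𝟙 (isIDS B (W ∖ v)) ∎
    where open Both W (holds eu) (holds ev)

  coefficients : ∀ k → coeff ids-G k + coeff with-uv k ≡ coeff ids-G-e k + coeff with-u k + coeff with-v k
  coefficients = coeff-additive ids-G with-uv ids-G-e with-u with-v pointwise

  x-A : ∀ k → (X^ 1 · ID A) k ≡ + coeff with-u k
  x-A = X-adjoin u (isIDS A) (λ W → isIDS-avoids A W u u∉A)

  x-B : ∀ k → (X^ 1 · ID B) k ≡ + coeff with-v k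
  x-B = X-adjoin v (isIDS B) (λ W → isIDS-avoids B W v Reversed.u∉A)

  with-v-N₂-avoids-u : ∀ W → T (with-v-N₂ W) → ¬ u ∈ₛ W
  with-v-N₂-avoids-u W t u∈W =
    isIDS-avoids N₂ (W ∖ v) u u∉N₂ (T-∧-snd (lookup W v) t) (∖-∈ W v u u∈W u≢v)

  x²-N₂ : ∀ k → (X^ 2 · ID N₂) k ≡ + coeff with-uv k
  x²-N₂ zero    = sym (cong +_ (coeff-adjoin-zero u with-v-N₂ with-v-N₂-avoids-u))
  x²-N₂ (suc k) = begin
    (X^ 1 · ID N₂) k          ≡⟨ X-adjoin v (isIDS N₂) (λ W → isIDS-avoids N₂ W v v∉N₂) k ⟩
    + coeff with-v-N₂ k       ≡⟨ cong +_ (coeff-adjoin-suc u with-v-N₂ with-v-N₂-avoids-u k) ⟨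
    + coeff with-uv (suc k)   ∎

mainTheorem15 : (n : ℕ) (G : SimpleGraph n) (u v : Fin n) →
    adj G u v ≡ true →
    (k : ℕ) →
    ID (toL G) k ≡
    (ID (deleteEdge (toL G) u v)
    ⊖ X^ 2 · ID (deleteClosedNbhd2 (toL G) u v)
    ⊕ X^ 1 · ID (deleteClosedNbhd (circ (toL G) v) u)
    ⊕ X^ 1 · ID (deleteClosedNbhd (circ (toL G) u) v)) k
mainTheorem15 n G u v uv k = begin
  ID (toL G) k
    ≡⟨ rearrange _ _ _ _ _ (coefficients k) ⟩
  + coeff ids-G-e k ℤ.- + coeff with-uv k ℤ.+ + coeff with-u k ℤ.+ + coeff with-v k
    ≡⟨ cong₂ ℤ._+_ (cong₂ (λ p q → ID G-e k ℤ.- p ℤ.+ q) (x²-N₂ k) (x-A k)) (x-B k) ⟨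
  (ID G-e ⊖ X^ 2 · ID N₂ ⊕ X^ 1 · ID A ⊕ X^ 1 · ID B) k ∎
  where
  open Recurrence G u v uv
  open ≡-Reasoning
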